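{- Let $\ell\ge 2$, let $A_1,\dots,A_\ell$ be pairwise disjoint nonempty finite sets, $V:=A_1\cup\dots\cup A_\ell$, and $\mathcal A:=\{A_1,\dots,A_\ell\}$. Let $\mathcal S$ be a family of $\ell$-element subsets of $V$ with $|S\cap A_i|=1$ for all $S\in\mathcal S$ and all $i$, such that for distinct $S,T\in\mathcal S$ the number $\ell-|S\cap T|$ is odd. For $X\subseteq V$ let $\vec X\in\mathbb F_2^V$ denote its characteristic vector. Suppose $|\mathcal S|$ is odd and the vectors $\{\vec X: X\in\mathcal S\cup\mathcal A\}$ admit a nontrivial linear dependency $\sum_{X\in\mathcal S\cup\mathcal A}\alpha(X)\vec X=\vec 0$ with coefficients $\alpha(X)\in\mathbb F_2$ not all zero. Then this dependency is unique and $\alpha(X)=1$ for every $X\in\mathcal S\cup\mathcal A$.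
   Context: $\mathbb F_2$ is the field with two elements. -}

module Defs where

open import Data.Bool using (Bool; true; false; _∧_; _xor_)
open import Data.Nat using (ℕ; zero; suc)
open import Data.Nat.DivMod using (_%_)
open import Data.Fin using (Fin; zero; suc; _≟_)
open import Data.Fin.Subset using (Subset)
open import Data.Vec using (Vec; tabulate; zipWith; replicate; map)
open import Relation.Nullary.Decidable using (⌊_⌋)
open import Relation.Binary.PropositionalEquality using (_≡_)

-- The field F₂ is modelled by Bool: addition = _xor_, multiplication = _∧_.
F₂ : Set
F₂ = Bool

Odd : ℕ → Set
Odd k = k % 2 ≡ 1

-- A subset X ⊆ V = Fin n (Data.Fin.Subset, i.e. Vec Bool n) *is* its
-- characteristic vector in F₂^V.
charVec : ∀ {n} → Subset n → Vec F₂ n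
charVec X = X

_⊕_ : ∀ {n} → Vec F₂ n → Vec F₂ n → Vec F₂ n
_⊕_ = zipWith _xor_

_·_ : ∀ {n} → F₂ → Vec F₂ n → Vec F₂ n
a · x = map (a ∧_) x

𝟎 : ∀ {n} → Vec F₂ n
𝟎 = replicate _ false

lincomb : ∀ {n} k → (Fin k → F₂) → (Fin k → Vec F₂ n) → Vec F₂ n
lincomb zero    α v = 𝟎
lincomb (suc k) α v = (α zero · v zero) ⊕ lincomb k (λ j → α (suc j)) (λ j → v (suc j))

-- The part A_i = { v ∈ V | part v = i } of the partition V = A_1 ∪ … ∪ A_ℓ
-- given by a map part : V → Fin ℓ.
block : ∀ {n ℓ} → (Fin n → Fin ℓ) → Fin ℓ → Subset n
block part i = tabulate (λ v → ⌊ part v ≟ i ⌋)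

{-# OPTIONS --safe #-}
module Submission where

-- Write ⟨x, y⟩ for the standard bilinear form on F₂^V, so ⟨X, Y⟩ = |X ∩ Y| mod 2 for
-- subsets. Pairing the dependency with S_k, and using ⟨S_j, S_k⟩ = ℓ + 1 (j ≠ k),
-- ⟨S_k, S_k⟩ = ℓ and ⟨A_i, S_k⟩ = 1, gives α(S_k) = (ℓ + 1) Σ α(S) + Σ α(A): all
-- α(S) share one value c. If c = 0, the coordinate of the dependency at a point of A_i
-- is α(A_i), so α vanishes, contradicting nontriviality. If c = 1, pairing with A_i
-- gives |𝒮| + α(A_i) |A_i| = 0, and |𝒮| odd forces α(A_i) = 1. Hence every
-- nontrivial dependency is the all-ones one, which gives uniqueness.

open import Defs
open import Algebra.Bundles using (CommutativeMonoid; CommutativeRing)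
open import Data.Bool using (true; false; not; _∧_; _xor_)
open import Data.Bool.Properties
  using (xor-∧-commutativeRing; xor-assoc; ∧-comm; ∧-assoc; ∧-zeroʳ; ∧-identityʳ; ∧-conicalˡ;
         ∧-distribˡ-xor; ∧-distribʳ-xor; not-involutive)
open import Data.Empty using (⊥-elim)
open import Data.Fin using (Fin; zero; suc; _≟_; punchIn)
open import Data.Fin.Properties using (punchInᵢ≢i)
open import Data.Fin.Subset using (Subset; ∣_∣; _∩_)
open import Data.Fin.Subset.Properties using (∩-idem; p∩q⊆p; p⊆q⇒∣p∣≤∣q∣)
open import Data.Nat using (ℕ; zero; suc; _+_; _≤_; _∸_)
open import Data.Nat.Properties using (m∸n+n≡m; ≤-trans; ≤-reflexive)
open import Data.Product using (_×_; Σ; _,_; proj₁; proj₂)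
open import Data.Vec using (Vec; []; _∷_; lookup)
open import Data.Vec.Functional using (Vector)
open import Data.Vec.Properties using (lookup-zipWith; lookup-map; lookup∘tabulate; map-replicate)
open import Function using (_∘_)
open import Relation.Nullary using (¬_; Dec; yes; no)
open import Relation.Nullary.Decidable using (⌊_⌋; isYes≗does; dec-true; dec-false)
open import Relation.Binary.PropositionalEquality
  using (_≡_; _≢_; refl; sym; trans; cong; cong₂; module ≡-Reasoning)

module _ {c e} (M : CommutativeMonoid c e) where
  open CommutativeMonoid M
    using (Carrier; _≈_; _∙_; ε; ∙-congˡ; identityʳ; setoid) renaming (trans to ≈-trans)
  open import Algebra.Properties.CommutativeMonoid.Sum M
    using (sum; sum-cong-≋; sum-replicate-zero; sum-remove)

  sum-zero : ∀ {m} (f : Vector Carrier m) → (∀ j → f j ≈ ε) → sum f ≈ ε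
  sum-zero {m} f f≈ε = ≈-trans (sum-cong-≋ f≈ε) (sum-replicate-zero m)

  sum-concentrated : ∀ {m} (f : Vector Carrier m) k → (∀ j → j ≢ k → f j ≈ ε) → sum f ≈ f k
  sum-concentrated {suc m} f k f≈ε = begin
    sum f
      ≈⟨ sum-remove f ⟩
    f k ∙ sum (f ∘ punchIn k)
      ≈⟨ ∙-congˡ (sum-zero (f ∘ punchIn k) (λ j → f≈ε _ (punchInᵢ≢i k j))) ⟩
    f k ∙ ε
      ≈⟨ identityʳ (f k) ⟩
    f k
      ∎
    where open import Relation.Binary.Reasoning.Setoid setoid

open CommutativeRing xor-∧-commutativeRing using (semiring; +-commutativeMonoid; +-group; +-monoid)
open import Algebra.Properties.Semiring.Sum semiring
  using (sum; sum-syntax; sum-cong-≗; sum-replicate; ∑-distrib-+; *-distribˡ-sum; *-distribʳ-sum)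
open import Algebra.Properties.Monoid.Mult +-monoid using (×-homo-+) renaming (_×_ to _×ₙ_)
open import Algebra.Properties.Group +-group using (x∙y⁻¹≈ε⇒x≈y)

xor≡false⇒≡ : ∀ x y → x xor y ≡ false → x ≡ y
xor≡false⇒≡ = x∙y⁻¹≈ε⇒x≈y

⌊⌋-true : ∀ {p} {P : Set p} (P? : Dec P) → P → ⌊ P? ⌋ ≡ true
⌊⌋-true P? p = trans (isYes≗does P?) (dec-true P? p)

⌊⌋-false : ∀ {p} {P : Set p} (P? : Dec P) → ¬ P → ⌊ P? ⌋ ≡ false
⌊⌋-false P? ¬p = trans (isYes≗does P?) (dec-false P? ¬p)

∑-δ : ∀ {m} (f : Fin m → F₂) k → ∑[ j < m ] (f j ∧ ⌊ k ≟ j ⌋) ≡ f k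
∑-δ f k = begin
  ∑[ j < _ ] (f j ∧ ⌊ k ≟ j ⌋)  ≡⟨ sum-concentrated +-commutativeMonoid _ k off-k ⟩
  f k ∧ ⌊ k ≟ k ⌋               ≡⟨ cong (f k ∧_) (⌊⌋-true (k ≟ k) refl) ⟩
  f k ∧ true                    ≡⟨ ∧-identityʳ (f k) ⟩
  f k                           ∎
  where
  open ≡-Reasoning
  off-k : ∀ j → j ≢ k → f j ∧ ⌊ k ≟ j ⌋ ≡ false
  off-k j j≢k = trans (cong (f j ∧_) (⌊⌋-false (k ≟ j) (j≢k ∘ sym))) (∧-zeroʳ (f j))

toF₂ : ℕ → F₂
toF₂ n = n ×ₙ true

toF₂-+ : ∀ a b → toF₂ (a + b) ≡ toF₂ a xor toF₂ b
toF₂-+ = ×-homo-+ true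

odd⇒toF₂≡true : ∀ k → Odd k → toF₂ k ≡ true
odd⇒toF₂≡true (suc zero)    _   = refl
odd⇒toF₂≡true (suc (suc k)) odd = trans (not-involutive (toF₂ k)) (odd⇒toF₂≡true k odd)

odd-∸⇒toF₂≡not : ∀ {c l} → c ≤ l → Odd (l ∸ c) → toF₂ c ≡ not (toF₂ l)
odd-∸⇒toF₂≡not {c} {l} c≤l odd = begin
  toF₂ c                         ≡⟨ not-involutive (toF₂ c) ⟨
  not (true xor toF₂ c)          ≡⟨ cong (λ b → not (b xor toF₂ c)) (odd⇒toF₂≡true (l ∸ c) odd) ⟨
  not (toF₂ (l ∸ c) xor toF₂ c)  ≡⟨ cong not (toF₂-+ (l ∸ c) c) ⟨
  not (toF₂ (l ∸ c + c))         ≡⟨ cong (not ∘ toF₂) (m∸n+n≡m c≤l) ⟩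
  not (toF₂ l)                   ∎
  where open ≡-Reasoning

⟨_,_⟩ : ∀ {n} → Vec F₂ n → Vec F₂ n → F₂
⟨_,_⟩ {n} x y = ∑[ v < n ] (lookup x v ∧ lookup y v)

⟨⟩-comm : ∀ {n} (x y : Vec F₂ n) → ⟨ x , y ⟩ ≡ ⟨ y , x ⟩
⟨⟩-comm x y = sum-cong-≗ (λ v → ∧-comm (lookup x v) (lookup y v))

sum-lookup : ∀ {n} (X : Subset n) → sum (lookup X) ≡ toF₂ ∣ X ∣
sum-lookup []          = refl
sum-lookup (true ∷ X)  = cong not (sum-lookup X)
sum-lookup (false ∷ X) = sum-lookup X

⟨⟩≡toF₂∣∩∣ : ∀ {n} (X Y : Subset n) → ⟨ X , Y ⟩ ≡ toF₂ ∣ X ∩ Y ∣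
⟨⟩≡toF₂∣∩∣ X Y = trans (sum-cong-≗ (λ v → sym (lookup-zipWith _∧_ v X Y))) (sum-lookup (X ∩ Y))

record IsLinear {n} (L : Vec F₂ n → F₂) : Set where
  field
    ⊕-homo : ∀ x y → L (x ⊕ y) ≡ L x xor L y
    ·-homo : ∀ a x → L (a · x) ≡ a ∧ L x

  𝟎-homo : L 𝟎 ≡ false
  𝟎-homo = trans (cong L (sym (map-replicate (false ∧_) false n))) (·-homo false 𝟎)

  lincomb-homo : ∀ k α (u : Fin k → Vec F₂ n) → L (lincomb k α u) ≡ ∑[ j < k ] (α j ∧ L (u j))
  lincomb-homo zero    α u = 𝟎-homo
  lincomb-homo (suc k) α u = trans (⊕-homo _ _)
    (cong₂ _xor_ (·-homo (α zero) (u zero)) (lincomb-homo k (α ∘ suc) (u ∘ suc)))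

  map-dependency : ∀ k α (u : Fin k → Vec F₂ n) l β (w : Fin l → Vec F₂ n) →
                   lincomb k α u ⊕ lincomb l β w ≡ 𝟎 →
                   ∑[ j < k ] (α j ∧ L (u j)) xor ∑[ i < l ] (β i ∧ L (w i)) ≡ false
  map-dependency k α u l β w dep = begin
    ∑[ j < k ] (α j ∧ L (u j)) xor ∑[ i < l ] (β i ∧ L (w i))
      ≡⟨ cong₂ _xor_ (lincomb-homo k α u) (lincomb-homo l β w) ⟨
    L (lincomb k α u) xor L (lincomb l β w)
      ≡⟨ ⊕-homo _ _ ⟨
    L (lincomb k α u ⊕ lincomb l β w)
      ≡⟨ cong L dep ⟩
    L 𝟎
      ≡⟨ 𝟎-homo ⟩
    false
      ∎
    where open ≡-Reasoning

lookup-linear : ∀ {n} (v : Fin n) → IsLinear (λ x → lookup x v)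
lookup-linear v = record
  { ⊕-homo = lookup-zipWith _xor_ v
  ; ·-homo = λ a → lookup-map v (a ∧_)
  }

⟨⟩-linear : ∀ {n} (z : Vec F₂ n) → IsLinear ⟨_, z ⟩
⟨⟩-linear {n} z = record { ⊕-homo = ⊕-homo′ ; ·-homo = ·-homo′ }
  where
  open ≡-Reasoning
  open IsLinear

  ⊕-homo′ : ∀ x y → ⟨ x ⊕ y , z ⟩ ≡ ⟨ x , z ⟩ xor ⟨ y , z ⟩
  ⊕-homo′ x y = begin
    ∑[ v < n ] (lookup (x ⊕ y) v ∧ lookup z v)
      ≡⟨ sum-cong-≗ (λ v → cong (_∧ lookup z v) (⊕-homo (lookup-linear v) x y)) ⟩
    ∑[ v < n ] ((lookup x v xor lookup y v) ∧ lookup z v)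
      ≡⟨ sum-cong-≗ (λ v → ∧-distribʳ-xor (lookup z v) (lookup x v) (lookup y v)) ⟩
    ∑[ v < n ] (lookup x v ∧ lookup z v xor lookup y v ∧ lookup z v)
      ≡⟨ ∑-distrib-+ (λ v → lookup x v ∧ lookup z v) (λ v → lookup y v ∧ lookup z v) ⟩
    ⟨ x , z ⟩ xor ⟨ y , z ⟩
      ∎

  ·-homo′ : ∀ a x → ⟨ a · x , z ⟩ ≡ a ∧ ⟨ x , z ⟩
  ·-homo′ a x = begin
    ∑[ v < n ] (lookup (a · x) v ∧ lookup z v)
      ≡⟨ sum-cong-≗ (λ v → cong (_∧ lookup z v) (·-homo (lookup-linear v) a x)) ⟩
    ∑[ v < n ] ((a ∧ lookup x v) ∧ lookup z v)
      ≡⟨ sum-cong-≗ (λ v → ∧-assoc a (lookup x v) (lookup z v)) ⟩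
    ∑[ v < n ] (a ∧ (lookup x v ∧ lookup z v))
      ≡⟨ *-distribˡ-sum a (λ v → lookup x v ∧ lookup z v) ⟨
    a ∧ ⟨ x , z ⟩
      ∎

module _ {n ℓ} (part : Fin n → Fin ℓ) where

  lookup-block : ∀ i v → lookup (block part i) v ≡ ⌊ part v ≟ i ⌋
  lookup-block i = lookup∘tabulate (λ v → ⌊ part v ≟ i ⌋)

  blocks-disjoint : ∀ {i i′} → i ≢ i′ → ⟨ block part i , block part i′ ⟩ ≡ false
  blocks-disjoint {i} {i′} i≢i′ = sum-zero +-commutativeMonoid _ λ v →
    trans (cong₂ _∧_ (lookup-block i v) (lookup-block i′ v)) (disjoint-at v)
    where
    disjoint-at : ∀ v → ⌊ part v ≟ i ⌋ ∧ ⌊ part v ≟ i′ ⌋ ≡ false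
    disjoint-at v with part v ≟ i
    ... | yes pv≡i = ⌊⌋-false (part v ≟ i′) (i≢i′ ∘ trans (sym pv≡i))
    ... | no  _    = refl

  ∑-lookup-blocks : ∀ (β : Fin ℓ → F₂) {i v} → part v ≡ i →
                    ∑[ i′ < ℓ ] (β i′ ∧ lookup (block part i′) v) ≡ β i
  ∑-lookup-blocks β {i} {v} pv≡i = begin
    ∑[ i′ < ℓ ] (β i′ ∧ lookup (block part i′) v)
      ≡⟨ sum-cong-≗ (λ i′ → cong (β i′ ∧_) (lookup-block i′ v)) ⟩
    ∑[ i′ < ℓ ] (β i′ ∧ ⌊ part v ≟ i′ ⌋)
      ≡⟨ cong (λ p → ∑[ i′ < ℓ ] (β i′ ∧ ⌊ p ≟ i′ ⌋)) pv≡i ⟩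
    ∑[ i′ < ℓ ] (β i′ ∧ ⌊ i ≟ i′ ⌋)
      ≡⟨ ∑-δ β i ⟩
    β i
      ∎
    where open ≡-Reasoning

  ∑-⟨⟩-blocks : ∀ (β : Fin ℓ → F₂) i →
                ∑[ i′ < ℓ ] (β i′ ∧ ⟨ block part i′ , block part i ⟩)
                  ≡ β i ∧ ⟨ block part i , block part i ⟩
  ∑-⟨⟩-blocks β i = sum-concentrated +-commutativeMonoid _ i λ i′ i′≢i →
    trans (cong (β i′ ∧_) (blocks-disjoint i′≢i)) (∧-zeroʳ (β i′))

module Transversals {n ℓ m} (part : Fin n → Fin ℓ) (S : Fin m → Subset n)
  (∣S∣≡ℓ : ∀ j → ∣ S j ∣ ≡ ℓ)
  (∣S∩A∣≡1 : ∀ j i → ∣ S j ∩ block part i ∣ ≡ 1)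
  (odd-gap : ∀ j k → j ≢ k → Odd (ℓ ∸ ∣ S j ∩ S k ∣))
  where

  A : Fin ℓ → Subset n
  A = block part

  ⟨S,S⟩ : ∀ j k → ⟨ S j , S k ⟩ ≡ ⌊ k ≟ j ⌋ xor not (toF₂ ℓ)
  ⟨S,S⟩ j k with k ≟ j
  ... | yes refl = begin
    ⟨ S k , S k ⟩       ≡⟨ ⟨⟩≡toF₂∣∩∣ (S k) (S k) ⟩
    toF₂ ∣ S k ∩ S k ∣  ≡⟨ cong (toF₂ ∘ ∣_∣) (∩-idem (S k)) ⟩
    toF₂ ∣ S k ∣        ≡⟨ cong toF₂ (∣S∣≡ℓ k) ⟩
    toF₂ ℓ              ≡⟨ not-involutive (toF₂ ℓ) ⟨
    not (not (toF₂ ℓ))  ∎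
    where open ≡-Reasoning
  ... | no k≢j =
    trans (⟨⟩≡toF₂∣∩∣ (S j) (S k)) (odd-∸⇒toF₂≡not ∣S∩S∣≤ℓ (odd-gap j k (k≢j ∘ sym)))
    where
    ∣S∩S∣≤ℓ : ∣ S j ∩ S k ∣ ≤ ℓ
    ∣S∩S∣≤ℓ = ≤-trans (p⊆q⇒∣p∣≤∣q∣ (p∩q⊆p (S j) (S k))) (≤-reflexive (∣S∣≡ℓ j))

  ⟨S,A⟩ : ∀ j i → ⟨ S j , A i ⟩ ≡ true
  ⟨S,A⟩ j i = trans (⟨⟩≡toF₂∣∩∣ (S j) (A i)) (cong toF₂ (∣S∩A∣≡1 j i))

  module _ (αS : Fin m → F₂) (αA : Fin ℓ → F₂)
           (dep : lincomb m αS (λ j → charVec (S j)) ⊕ lincomb ℓ αA (λ i → charVec (A i)) ≡ 𝟎)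
    where

    vanishes-under : ∀ {L} → IsLinear L →
                     ∑[ j < m ] (αS j ∧ L (S j)) xor ∑[ i < ℓ ] (αA i ∧ L (A i)) ≡ false
    vanishes-under L-linear = IsLinear.map-dependency L-linear m αS S ℓ αA A dep

    αS-constant : ∀ k → αS k ≡ (sum αS ∧ not (toF₂ ℓ)) xor sum αA
    αS-constant k = xor≡false⇒≡ (αS k) _ (begin
      αS k xor ((sum αS ∧ c) xor sum αA)  ≡⟨ xor-assoc (αS k) _ _ ⟨
      (αS k xor (sum αS ∧ c)) xor sum αA  ≡⟨ cong₂ _xor_ pairing-S pairing-A ⟨
      ∑[ j < m ] (αS j ∧ ⟨ S j , S k ⟩) xor ∑[ i < ℓ ] (αA i ∧ ⟨ A i , S k ⟩)
                                          ≡⟨ vanishes-under (⟨⟩-linear (S k)) ⟩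
      false                               ∎)
      where
      open ≡-Reasoning
      c : F₂
      c = not (toF₂ ℓ)
      pairing-S : ∑[ j < m ] (αS j ∧ ⟨ S j , S k ⟩) ≡ αS k xor (sum αS ∧ c)
      pairing-S = begin
        ∑[ j < m ] (αS j ∧ ⟨ S j , S k ⟩)
          ≡⟨ sum-cong-≗ (λ j → cong (αS j ∧_) (⟨S,S⟩ j k)) ⟩
        ∑[ j < m ] (αS j ∧ (⌊ k ≟ j ⌋ xor c))
          ≡⟨ sum-cong-≗ (λ j → ∧-distribˡ-xor (αS j) _ c) ⟩
        ∑[ j < m ] (αS j ∧ ⌊ k ≟ j ⌋ xor αS j ∧ c)
          ≡⟨ ∑-distrib-+ (λ j → αS j ∧ ⌊ k ≟ j ⌋) (λ j → αS j ∧ c) ⟩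
        ∑[ j < m ] (αS j ∧ ⌊ k ≟ j ⌋) xor ∑[ j < m ] (αS j ∧ c)
          ≡⟨ cong₂ _xor_ (∑-δ αS k) (sym (*-distribʳ-sum c αS)) ⟩
        αS k xor (sum αS ∧ c)
          ∎
      pairing-A : ∑[ i < ℓ ] (αA i ∧ ⟨ A i , S k ⟩) ≡ sum αA
      pairing-A = sum-cong-≗ λ i →
        trans (cong (αA i ∧_) (trans (⟨⟩-comm (A i) (S k)) (⟨S,A⟩ k i))) (∧-identityʳ (αA i))

    αS≡false⇒αA≡false : (∀ i → Σ (Fin n) (λ v → part v ≡ i)) →
                        (∀ j → αS j ≡ false) → ∀ i → αA i ≡ false
    αS≡false⇒αA≡false cover αS≡false i = sym (xor≡false⇒≡ false (αA i) paired)
      where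
      v : Fin n
      v = proj₁ (cover i)
      S-part : ∑[ j < m ] (αS j ∧ lookup (S j) v) ≡ false
      S-part = sum-zero +-commutativeMonoid _ λ j → cong (_∧ lookup (S j) v) (αS≡false j)
      A-part : ∑[ i′ < ℓ ] (αA i′ ∧ lookup (A i′) v) ≡ αA i
      A-part = ∑-lookup-blocks part αA (proj₂ (cover i))
      paired : false xor αA i ≡ false
      paired = trans (cong₂ _xor_ (sym S-part) (sym A-part)) (vanishes-under (lookup-linear v))

    αS≡true⇒αA≡true : Odd m → (∀ j → αS j ≡ true) → ∀ i → αA i ≡ true
    αS≡true⇒αA≡true odd-m αS≡true i =
      ∧-conicalˡ (αA i) ⟨ A i , A i ⟩ (sym (xor≡false⇒≡ true _ paired))
      where
      open ≡-Reasoning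
      S-part : ∑[ j < m ] (αS j ∧ ⟨ S j , A i ⟩) ≡ true
      S-part = begin
        ∑[ j < m ] (αS j ∧ ⟨ S j , A i ⟩)
          ≡⟨ sum-cong-≗ (λ j → cong₂ _∧_ (αS≡true j) (⟨S,A⟩ j i)) ⟩
        ∑[ j < m ] true
          ≡⟨ sum-replicate m ⟩
        toF₂ m
          ≡⟨ odd⇒toF₂≡true m odd-m ⟩
        true
          ∎
      A-part : ∑[ i′ < ℓ ] (αA i′ ∧ ⟨ A i′ , A i ⟩) ≡ αA i ∧ ⟨ A i , A i ⟩
      A-part = ∑-⟨⟩-blocks part αA i
      paired : true xor (αA i ∧ ⟨ A i , A i ⟩) ≡ false
      paired = trans (cong₂ _xor_ (sym S-part) (sym A-part)) (vanishes-under (⟨⟩-linear (A i)))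

    all-true : (∀ i → Σ (Fin n) (λ v → part v ≡ i)) → Odd m →
               ¬ ((∀ j → αS j ≡ false) × (∀ i → αA i ≡ false)) →
               (∀ j → αS j ≡ true) × (∀ i → αA i ≡ true)
    all-true cover odd-m nontrivial with (sum αS ∧ not (toF₂ ℓ)) xor sum αA | αS-constant
    ... | false | αS≡false = ⊥-elim (nontrivial (αS≡false , αS≡false⇒αA≡false cover αS≡false))
    ... | true  | αS≡true  = αS≡true , αS≡true⇒αA≡true odd-m αS≡true

lemma3p2 : (n ℓ m : ℕ) → 2 ≤ ℓ →
  (part : Fin n → Fin ℓ) → (∀ i → Σ (Fin n) (λ v → part v ≡ i)) →
  (S : Fin m → Subset n) → (∀ j k → S j ≡ S k → j ≡ k) →
  (∀ j → ∣ S j ∣ ≡ ℓ) →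
  (∀ j i → ∣ S j ∩ block part i ∣ ≡ 1) →
  (∀ j k → j ≢ k → Odd (ℓ ∸ ∣ S j ∩ S k ∣)) →
  Odd m →
  (αS : Fin m → F₂) → (αA : Fin ℓ → F₂) →
  lincomb m αS (λ j → charVec (S j)) ⊕ lincomb ℓ αA (λ i → charVec (block part i)) ≡ 𝟎 →
  ¬ ((∀ j → αS j ≡ false) × (∀ i → αA i ≡ false)) →
  ((∀ j → αS j ≡ true) × (∀ i → αA i ≡ true))
  × ((βS : Fin m → F₂) → (βA : Fin ℓ → F₂) →
     lincomb m βS (λ j → charVec (S j)) ⊕ lincomb ℓ βA (λ i → charVec (block part i)) ≡ 𝟎 →
     ¬ ((∀ j → βS j ≡ false) × (∀ i → βA i ≡ false)) →
     (∀ j → βS j ≡ αS j) × (∀ i → βA i ≡ αA i))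
lemma3p2 n ℓ m _ part cover S _ ∣S∣≡ℓ ∣S∩A∣≡1 odd-gap odd-m αS αA dep nontrivial =
  α-true , λ βS βA depβ nontrivialβ → agree (all-true βS βA depβ cover odd-m nontrivialβ)
  where
  open Transversals part S ∣S∣≡ℓ ∣S∩A∣≡1 odd-gap
  α-true : (∀ j → αS j ≡ true) × (∀ i → αA i ≡ true)
  α-true = all-true αS αA dep cover odd-m nontrivial
  agree : ∀ {βS : Fin m → F₂} {βA : Fin ℓ → F₂} →
          (∀ j → βS j ≡ true) × (∀ i → βA i ≡ true) →
          (∀ j → βS j ≡ αS j) × (∀ i → βA i ≡ αA i)
  agree (βS-true , βA-true) =
      (λ j → trans (βS-true j) (sym (proj₁ α-true j)))
    , (λ i → trans (βA-true i) (sym (proj₂ α-true i)))
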